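{- For every positive integer $n$, \[ \sum_{m=0}^\infty\frac{\tau_m(n)^2}{m!\,n^m}=\frac{n!}{(n/e)^n}. \]
   Context: For integers $n\ge0$, $\tau_m(n)=n!\,[x^n]\bigl(e^x(x-n)^m\bigr)$, where $[x^n]$ denotes the coefficient of $x^n$ in the power series; equivalently $\sum_{m\ge0}\frac{\tau_m(n)}{m!}z^m=((1+z)e^{ -z})^n$. -}

module Defs where

open import Data.Nat as ℕ using (ℕ; zero; suc; _∸_; _!; NonZero)
open import Data.Nat.Properties using (_!≢0; m^n≢0; m*n≢0)
open import Data.Integer as ℤ using (ℤ; +_)
open import Data.Rational as ℚ using (ℚ; 0ℚ)

Σ< : ℕ → (ℕ → ℚ) → ℚ
Σ< zero    f = 0ℚ
Σ< (suc N) f = Σ< N f ℚ.+ f N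

-- polyPowCoeff n m k = coefficient of x^k in the polynomial (x - n)^m,
-- computed by repeated multiplication by (x - n).
polyPowCoeff : ℕ → ℕ → ℕ → ℤ
polyPowCoeff n zero    zero    = + 1
polyPowCoeff n zero    (suc k) = + 0
polyPowCoeff n (suc m) zero    = ℤ.- (+ n ℤ.* polyPowCoeff n m zero)
polyPowCoeff n (suc m) (suc k) = polyPowCoeff n m k ℤ.- (+ n ℤ.* polyPowCoeff n m (suc k))

expCoeff : ℕ → ℚ
expCoeff k = (+ 1 ℚ./ (k !)) {{k !≢0}}

-- τ_m(n) = n! [x^n] (e^x (x-n)^m); the coefficient of x^n of the product
-- of the power series is the Cauchy product Σ_{k=0}^{n} [x^k](x-n)^m · [x^{n-k}] e^x.
τ : ℕ → ℕ → ℚ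
τ m n = ((+ (n !)) ℚ./ 1) ℚ.* Σ< (suc n) (λ k → (polyPowCoeff n m k ℚ./ 1) ℚ.* expCoeff (n ∸ k))

lhsTerm : (n : ℕ) → .{{NonZero n}} → ℕ → ℚ
lhsTerm n m = τ m n ℚ.* τ m n ℚ.* (+ 1 ℚ./ (m ! ℕ.* n ℕ.^ m))
  {{ m*n≢0 (m !) (n ℕ.^ m) {{m !≢0}} {{m^n≢0 n m}} }}

-- e^n is (by definition of exp) the sum of the series Σ_k n^k / k!;
-- so n!/(n/e)^n = (n!/n^n) · Σ_k n^k/k!.  This is its k-th term.
rhsTerm : (n : ℕ) → .{{NonZero n}} → ℕ → ℚ
rhsTerm n k = (+ (n ! ℕ.* n ℕ.^ k) ℚ./ (n ℕ.^ n ℕ.* k !))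
  {{ m*n≢0 (n ℕ.^ n) (k !) {{m^n≢0 n n}} {{k !≢0}} }}

{-# OPTIONS --safe #-}
-- Write τ m n = (-n)ᵐ p(m), where p(m) = Σᵢ cᵢ (m C i) with cᵢ = n!/(n-i)! · (-1/n)ⁱ is a polynomial
-- of degree n; the m-th term of the series is then (nᵐ/m!) p(m)². Expanding one factor p(m) in the
-- binomial basis and using Σₘ (nᵐ/m!) (m C i) f(m) = (nⁱ/i!) Σⱼ (nʲ/j!) f(i+j) turns the series into
-- Σⱼ (nʲ/j!) Σᵢ (n C i) (-1)ⁱ p(i+j). The inner sum is (-1)ⁿ times the n-th difference of p, i.e. the
-- constant (-1)ⁿ cₙ = n!/nⁿ, so the series equals (n!/nⁿ) Σⱼ nʲ/j! = n!/(n/e)ⁿ.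
-- For partial sums the two sides differ only by boundary terms with indices in [N, N + n), each
-- bounded by a constant times (4n)ᵐ/m!, and this sequence halves at every step once m ≥ 8n.
module Submission where

open import Defs
open import Data.Nat using (ℕ; NonZero; _≤_)
open import Data.Product using (∃)
open import Data.Rational using (ℚ; 0ℚ; _<_; _-_; ∣_∣)

open import Algebra.Bundles using (CommutativeRing)
open import Data.Nat.Base as ℕ using (zero; suc; _!; _∸_; z≤n; s≤s)
import Data.Nat.Properties as ℕₚ
open import Data.Nat.Combinatorics
  using (_C_; nCk≡n!/k![n-k]!; k![n∸k]!∣n!; k>n⇒nCk≡0; nCk+nC[k+1]≡[n+1]C[k+1])
open import Data.Nat.DivMod using (m/n*n≡m)
open import Data.Integer.Base as ℤ using (ℤ; +_)
import Data.Integer.Properties as ℤₚ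
open import Data.Product using (_,_; proj₁; proj₂)
open import Data.Sum using (inj₁; inj₂)
open import Data.Rational.Base as ℚ using (1ℚ; _+_; _*_; -_; _/_; toℚᵘ; mkℚ)
import Data.Rational.Properties as ℚₚ
open import Data.Rational.Solver using (module +-*-Solver)
open +-*-Solver using (solve; _:=_; _:+_; _:*_; _:-_; :-_; con)
import Data.Rational.Unnormalised.Base as ℚᵘ
import Data.Rational.Unnormalised.Properties as ℚᵘₚ
open import Relation.Binary.PropositionalEquality

open import Algebra.Properties.CommutativeSemiring.Exp
  (CommutativeRing.commutativeSemiring ℚₚ.+-*-commutativeRing) using (_^_; ^-homo-*; ^-distrib-*)

-- Written i / 1, as in Defs, so that the casts occurring there are definitionally fromℤ and fromℕ.
fromℤ : ℤ → ℚ
fromℤ i = i / 1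

fromℕ : ℕ → ℚ
fromℕ a = fromℤ (+ a)

1/ℕ : (d : ℕ) → .{{NonZero d}} → ℚ
1/ℕ d = + 1 / d

toℚᵘ-/ : ∀ i d .{{_ : NonZero d}} → toℚᵘ (i / d) ℚᵘ.≃ (i ℚᵘ./ d)
toℚᵘ-/ i (suc d) = ℚₚ.toℚᵘ-fromℚᵘ (ℚᵘ.mkℚᵘ i d)

toℚᵘ-injective-≃ : ∀ {p q P Q} → toℚᵘ p ℚᵘ.≃ P → toℚᵘ q ℚᵘ.≃ Q → P ℚᵘ.≃ Q → p ≡ q
toℚᵘ-injective-≃ p≃P q≃Q P≃Q =
  ℚₚ.toℚᵘ-injective (ℚᵘₚ.≃-trans p≃P (ℚᵘₚ.≃-trans P≃Q (ℚᵘₚ.≃-sym q≃Q)))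

fromℤ-homo-+ : ∀ i j → fromℤ (i ℤ.+ j) ≡ fromℤ i + fromℤ j
fromℤ-homo-+ i j = toℚᵘ-injective-≃ (toℚᵘ-/ (i ℤ.+ j) 1)
  (ℚᵘₚ.≃-trans (ℚₚ.toℚᵘ-homo-+ (fromℤ i) (fromℤ j)) (ℚᵘₚ.+-cong (toℚᵘ-/ i 1) (toℚᵘ-/ j 1)))
  (ℚᵘ.*≡* (cong (ℤ._* + 1) (sym (cong₂ ℤ._+_ (ℤₚ.*-identityʳ i) (ℤₚ.*-identityʳ j)))))

fromℤ-homo-* : ∀ i j → fromℤ (i ℤ.* j) ≡ fromℤ i * fromℤ j
fromℤ-homo-* i j = toℚᵘ-injective-≃ (toℚᵘ-/ (i ℤ.* j) 1)
  (ℚᵘₚ.≃-trans (ℚₚ.toℚᵘ-homo-* (fromℤ i) (fromℤ j)) (ℚᵘₚ.*-cong (toℚᵘ-/ i 1) (toℚᵘ-/ j 1)))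
  (ℚᵘ.*≡* refl)

fromℤ-homo‿- : ∀ i → fromℤ (ℤ.- i) ≡ - fromℤ i
fromℤ-homo‿- i = toℚᵘ-injective-≃ (toℚᵘ-/ (ℤ.- i) 1)
  (ℚᵘₚ.≃-trans (ℚₚ.toℚᵘ-homo‿- (fromℤ i)) (ℚᵘₚ.-‿cong (toℚᵘ-/ i 1)))
  (ℚᵘ.*≡* refl)

fromℕ-homo-+ : ∀ a b → fromℕ (a ℕ.+ b) ≡ fromℕ a + fromℕ b
fromℕ-homo-+ a b = trans (cong fromℤ (ℤₚ.pos-+ a b)) (fromℤ-homo-+ (+ a) (+ b))

fromℕ-homo-* : ∀ a b → fromℕ (a ℕ.* b) ≡ fromℕ a * fromℕ b
fromℕ-homo-* a b = trans (cong fromℤ (ℤₚ.pos-* a b)) (fromℤ-homo-* (+ a) (+ b))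

fromℕ-homo-^ : ∀ a m → fromℕ (a ℕ.^ m) ≡ fromℕ a ^ m
fromℕ-homo-^ a zero    = refl
fromℕ-homo-^ a (suc m) = trans (fromℕ-homo-* a (a ℕ.^ m)) (cong (fromℕ a *_) (fromℕ-homo-^ a m))

/-as-* : ∀ i d .{{_ : NonZero d}} → i / d ≡ fromℤ i * 1/ℕ d
/-as-* i d@(suc _) = toℚᵘ-injective-≃ (toℚᵘ-/ i d)
  (ℚᵘₚ.≃-trans (ℚₚ.toℚᵘ-homo-* (fromℤ i) (1/ℕ d)) (ℚᵘₚ.*-cong (toℚᵘ-/ i 1) (toℚᵘ-/ (+ 1) d)))
  (ℚᵘ.*≡* (trans (cong (λ e → i ℤ.* + e) (ℕₚ.*-identityˡ d)) (cong (ℤ._* + d) (sym (ℤₚ.*-identityʳ i)))))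

fromℕ*1/ℕ : ∀ d .{{_ : NonZero d}} → fromℕ d * 1/ℕ d ≡ 1ℚ
fromℕ*1/ℕ d@(suc _) = trans (sym (/-as-* (+ d) d))
  (toℚᵘ-injective-≃ (toℚᵘ-/ (+ d) d) ℚᵘₚ.≃-refl (ℚᵘ.*≡* (ℤₚ.*-comm (+ d) (+ 1))))

1/ℕ-homo-* : ∀ a b .{{_ : NonZero a}} .{{_ : NonZero b}} →
             1/ℕ (a ℕ.* b) {{ℕₚ.m*n≢0 a b}} ≡ 1/ℕ a * 1/ℕ b
1/ℕ-homo-* a@(suc _) b@(suc _) = toℚᵘ-injective-≃ (toℚᵘ-/ (+ 1) (a ℕ.* b))
  (ℚᵘₚ.≃-trans (ℚₚ.toℚᵘ-homo-* (1/ℕ a) (1/ℕ b)) (ℚᵘₚ.*-cong (toℚᵘ-/ (+ 1) a) (toℚᵘ-/ (+ 1) b)))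
  (ℚᵘ.*≡* refl)

1/ℕ-homo-^ : ∀ a m .{{_ : NonZero a}} → 1/ℕ (a ℕ.^ m) {{ℕₚ.m^n≢0 a m}} ≡ 1/ℕ a ^ m
1/ℕ-homo-^ a zero    = refl
1/ℕ-homo-^ a (suc m) = trans (1/ℕ-homo-* a (a ℕ.^ m)) (cong (1/ℕ a *_) (1/ℕ-homo-^ a m))
  where instance _ = ℕₚ.m^n≢0 a m

1^n≡1 : ∀ k → 1ℚ ^ k ≡ 1ℚ
1^n≡1 zero    = refl
1^n≡1 (suc k) = trans (ℚₚ.*-identityˡ (1ℚ ^ k)) (1^n≡1 k)

fromℕ-mono-≤ : ∀ {a b} → a ≤ b → fromℕ a ℚ.≤ fromℕ b
fromℕ-mono-≤ {a} {b} a≤b = ℚₚ.toℚᵘ-cancel-≤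
  (ℚᵘₚ.≤-respˡ-≃ (ℚᵘₚ.≃-sym (toℚᵘ-/ (+ a) 1)) (ℚᵘₚ.≤-respʳ-≃ (ℚᵘₚ.≃-sym (toℚᵘ-/ (+ b) 1))
    (ℚᵘ.*≤* (ℤₚ.*-monoʳ-≤-nonNeg (+ 1) (ℤ.+≤+ a≤b)))))

0≤fromℕ : ∀ a → 0ℚ ℚ.≤ fromℕ a
0≤fromℕ a = fromℕ-mono-≤ {0} {a} z≤n

0≤1/ℕ : ∀ d .{{_ : NonZero d}} → 0ℚ ℚ.≤ 1/ℕ d
0≤1/ℕ d@(suc _) =
  ℚₚ.toℚᵘ-cancel-≤ (ℚᵘₚ.≤-respʳ-≃ (ℚᵘₚ.≃-sym (toℚᵘ-/ (+ 1) d)) (ℚᵘ.*≤* (ℤ.+≤+ z≤n)))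

archimedean : ∀ p → ∃ λ k → p < fromℕ k
archimedean p@(mkℚ ℤ.-[1+ _ ] _ _) = 0 , ℚₚ.negative⁻¹ p
archimedean p@(mkℚ (+ a) d-1 _)    = suc a , ℚₚ.toℚᵘ-cancel-< (ℚᵘₚ.<-respʳ-≃ (ℚᵘₚ.≃-sym (toℚᵘ-/ (+ suc a) 1))
  (ℚᵘ.*<* (subst₂ ℤ._<_ (sym (ℤₚ.*-identityʳ (+ a))) (ℤₚ.pos-* (suc a) (suc d-1))
    (ℤ.+<+ (ℕₚ.m≤m*n (suc a) (suc d-1))))))

*-monoˡ-≤-nonNeg : ∀ {r p q} → 0ℚ ℚ.≤ r → p ℚ.≤ q → r * p ℚ.≤ r * q
*-monoˡ-≤-nonNeg {r} 0≤r = ℚₚ.*-monoˡ-≤-nonNeg r {{ℚ.nonNegative 0≤r}}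

*-monoʳ-≤-nonNeg : ∀ {r p q} → 0ℚ ℚ.≤ r → p ℚ.≤ q → p * r ℚ.≤ q * r
*-monoʳ-≤-nonNeg {r} 0≤r = ℚₚ.*-monoʳ-≤-nonNeg r {{ℚ.nonNegative 0≤r}}

*-mono-≤-nonNeg : ∀ {p q r s} → 0ℚ ℚ.≤ p → 0ℚ ℚ.≤ r → p ℚ.≤ q → r ℚ.≤ s → p * r ℚ.≤ q * s
*-mono-≤-nonNeg 0≤p 0≤r p≤q r≤s =
  ℚₚ.≤-trans (*-monoʳ-≤-nonNeg 0≤r p≤q) (*-monoˡ-≤-nonNeg (ℚₚ.≤-trans 0≤p p≤q) r≤s)

nonNeg*nonNeg⇒nonNeg : ∀ {p q} → 0ℚ ℚ.≤ p → 0ℚ ℚ.≤ q → 0ℚ ℚ.≤ p * q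
nonNeg*nonNeg⇒nonNeg {p} {q} 0≤p 0≤q = subst (ℚ._≤ p * q) (ℚₚ.*-zeroˡ q) (*-monoʳ-≤-nonNeg 0≤q 0≤p)

p≤q+p : ∀ {p q} → 0ℚ ℚ.≤ q → p ℚ.≤ q + p
p≤q+p {p} {q} 0≤q = ℚₚ.≤-trans (ℚₚ.≤-reflexive (sym (ℚₚ.+-identityˡ p))) (ℚₚ.+-monoˡ-≤ p 0≤q)

module FiniteSum where

  Σ<-cong : ∀ N {f g : ℕ → ℚ} → (∀ k → k ℕ.< N → f k ≡ g k) → Σ< N f ≡ Σ< N g
  Σ<-cong zero    f≡g = refl
  Σ<-cong (suc N) f≡g = cong₂ _+_ (Σ<-cong N (λ k k<N → f≡g k (ℕₚ.m<n⇒m<1+n k<N))) (f≡g N ℕₚ.≤-refl)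

  Σ<-zero : ∀ N {f : ℕ → ℚ} → (∀ k → k ℕ.< N → f k ≡ 0ℚ) → Σ< N f ≡ 0ℚ
  Σ<-zero N f≡0 = trans (Σ<-cong N f≡0) (Σ<-const0 N)
    where
    Σ<-const0 : ∀ N → Σ< N (λ _ → 0ℚ) ≡ 0ℚ
    Σ<-const0 zero    = refl
    Σ<-const0 (suc N) = trans (ℚₚ.+-identityʳ _) (Σ<-const0 N)

  Σ<-neg : ∀ N (f : ℕ → ℚ) → - Σ< N f ≡ Σ< N (λ k → - f k)
  Σ<-neg zero    f = refl
  Σ<-neg (suc N) f = trans (ℚₚ.neg-distrib-+ (Σ< N f) (f N)) (cong (_+ - f N) (Σ<-neg N f))

  Σ<-distrib-+ : ∀ N (f g : ℕ → ℚ) → Σ< N (λ k → f k + g k) ≡ Σ< N f + Σ< N g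
  Σ<-distrib-+ zero    f g = refl
  Σ<-distrib-+ (suc N) f g = trans (cong (_+ (f N + g N)) (Σ<-distrib-+ N f g))
    (solve 4 (λ a b c d → (a :+ b) :+ (c :+ d) := (a :+ c) :+ (b :+ d)) refl (Σ< N f) (Σ< N g) (f N) (g N))

  *-distribˡ-Σ< : ∀ N c (f : ℕ → ℚ) → c * Σ< N f ≡ Σ< N (λ k → c * f k)
  *-distribˡ-Σ< zero    c f = ℚₚ.*-zeroʳ c
  *-distribˡ-Σ< (suc N) c f = trans (ℚₚ.*-distribˡ-+ c (Σ< N f) (f N)) (cong (_+ c * f N) (*-distribˡ-Σ< N c f))

  *-distribʳ-Σ< : ∀ N c (f : ℕ → ℚ) → Σ< N f * c ≡ Σ< N (λ k → f k * c)
  *-distribʳ-Σ< N c f = trans (ℚₚ.*-comm (Σ< N f) c)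
    (trans (*-distribˡ-Σ< N c f) (Σ<-cong N (λ k _ → ℚₚ.*-comm c (f k))))

  Σ<-+ : ∀ a b (f : ℕ → ℚ) → Σ< (a ℕ.+ b) f ≡ Σ< a f + Σ< b (λ t → f (a ℕ.+ t))
  Σ<-+ a zero    f = trans (cong (λ N → Σ< N f) (ℕₚ.+-identityʳ a)) (sym (ℚₚ.+-identityʳ (Σ< a f)))
  Σ<-+ a (suc b) f = begin
    Σ< (a ℕ.+ suc b) f                               ≡⟨ cong (λ N → Σ< N f) (ℕₚ.+-suc a b) ⟩
    Σ< (a ℕ.+ b) f + f (a ℕ.+ b)                     ≡⟨ cong (_+ f (a ℕ.+ b)) (Σ<-+ a b f) ⟩
    (Σ< a f + Σ< b (λ t → f (a ℕ.+ t))) + f (a ℕ.+ b) ≡⟨ ℚₚ.+-assoc (Σ< a f) _ _ ⟩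
    Σ< a f + Σ< (suc b) (λ t → f (a ℕ.+ t))          ∎
    where open ≡-Reasoning

  Σ<-head : ∀ N (f : ℕ → ℚ) → Σ< (suc N) f ≡ f 0 + Σ< N (λ k → f (suc k))
  Σ<-head N f = trans (Σ<-+ 1 N f) (cong (_+ Σ< N (λ k → f (suc k))) (ℚₚ.+-identityˡ (f 0)))

  Σ<-comm : ∀ A B (f : ℕ → ℕ → ℚ) → Σ< A (λ i → Σ< B (f i)) ≡ Σ< B (λ j → Σ< A (λ i → f i j))
  Σ<-comm zero    B f = sym (Σ<-zero B (λ _ _ → refl))
  Σ<-comm (suc A) B f = trans (cong (_+ Σ< B (f A)) (Σ<-comm A B f)) (sym (Σ<-distrib-+ B _ (f A)))

  Σ<-mono-≤ : ∀ N {f g : ℕ → ℚ} → (∀ k → k ℕ.< N → f k ℚ.≤ g k) → Σ< N f ℚ.≤ Σ< N g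
  Σ<-mono-≤ zero    f≤g = ℚₚ.≤-refl
  Σ<-mono-≤ (suc N) f≤g = ℚₚ.+-mono-≤ (Σ<-mono-≤ N (λ k k<N → f≤g k (ℕₚ.m<n⇒m<1+n k<N))) (f≤g N ℕₚ.≤-refl)

  ∣Σ<∣≤Σ<∣∣ : ∀ N (f : ℕ → ℚ) → ∣ Σ< N f ∣ ℚ.≤ Σ< N (λ k → ∣ f k ∣)
  ∣Σ<∣≤Σ<∣∣ zero    f = ℚₚ.≤-refl
  ∣Σ<∣≤Σ<∣∣ (suc N) f =
    ℚₚ.≤-trans (ℚₚ.∣p+q∣≤∣p∣+∣q∣ (Σ< N f) (f N)) (ℚₚ.+-monoˡ-≤ ∣ f N ∣ (∣Σ<∣≤Σ<∣∣ N f))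

  ∣Σ<∣≤N* : ∀ N (f : ℕ → ℚ) c → (∀ k → k ℕ.< N → ∣ f k ∣ ℚ.≤ c) → ∣ Σ< N f ∣ ℚ.≤ fromℕ N * c
  ∣Σ<∣≤N* N f c ∣f∣≤c =
    ℚₚ.≤-trans (∣Σ<∣≤Σ<∣∣ N f) (ℚₚ.≤-trans (Σ<-mono-≤ N ∣f∣≤c) (ℚₚ.≤-reflexive (Σ<-const N)))
    where
    Σ<-const : ∀ N → Σ< N (λ _ → c) ≡ fromℕ N * c
    Σ<-const zero    = sym (ℚₚ.*-zeroˡ c)
    Σ<-const (suc N) = begin
      Σ< N (λ _ → c) + c    ≡⟨ cong (_+ c) (Σ<-const N) ⟩
      fromℕ N * c + c       ≡⟨ solve 2 (λ x c → x :* c :+ c := (con 1ℚ :+ x) :* c) refl (fromℕ N) c ⟩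
      (1ℚ + fromℕ N) * c    ≡⟨ cong (_* c) (sym (fromℕ-homo-+ 1 N)) ⟩
      fromℕ (suc N) * c     ∎
      where open ≡-Reasoning

  ∣Σ<*∣≤ : ∀ N (f g : ℕ → ℚ) c → (∀ k → k ℕ.< N → ∣ g k ∣ ℚ.≤ c) →
           ∣ Σ< N (λ k → f k * g k) ∣ ℚ.≤ Σ< N (λ k → ∣ f k ∣) * c
  ∣Σ<*∣≤ N f g c ∣g∣≤c = begin
    ∣ Σ< N (λ k → f k * g k) ∣       ≤⟨ ∣Σ<∣≤Σ<∣∣ N _ ⟩
    Σ< N (λ k → ∣ f k * g k ∣)       ≤⟨ Σ<-mono-≤ N term ⟩
    Σ< N (λ k → ∣ f k ∣ * c)         ≡⟨ sym (*-distribʳ-Σ< N c _) ⟩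
    Σ< N (λ k → ∣ f k ∣) * c         ∎
    where
    open ℚₚ.≤-Reasoning
    term : ∀ k → k ℕ.< N → ∣ f k * g k ∣ ℚ.≤ ∣ f k ∣ * c
    term k k<N = ℚₚ.≤-trans (ℚₚ.≤-reflexive (ℚₚ.∣p*q∣≡∣p∣*∣q∣ (f k) (g k)))
                             (*-monoˡ-≤-nonNeg (ℚₚ.0≤∣p∣ (f k)) (∣g∣≤c k k<N))

module Binomial where

  nCk*[k!*[n∸k]!]≡n! : ∀ {n k} → k ≤ n → (n C k) ℕ.* (k ! ℕ.* (n ∸ k) !) ≡ n !
  nCk*[k!*[n∸k]!]≡n! {n} {k} k≤n =
    trans (cong (ℕ._* (k ! ℕ.* (n ∸ k) !)) (nCk≡n!/k![n-k]! k≤n)) (m/n*n≡m (k![n∸k]!∣n! k≤n))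
    where instance _ = k ℕₚ.!* (n ∸ k) !≢0

  fromℕ-nCk : ∀ {n k} → k ≤ n → fromℕ (n C k) ≡ fromℕ (n !) * (expCoeff k * expCoeff (n ∸ k))
  fromℕ-nCk {n} {k} k≤n = begin
    fromℕ (n C k)
      ≡⟨ solve 1 (λ c → c := c :* (con 1ℚ :* con 1ℚ)) refl (fromℕ (n C k)) ⟩
    fromℕ (n C k) * (1ℚ * 1ℚ)
      ≡⟨ cong₂ (λ x y → fromℕ (n C k) * (x * y)) (sym (fromℕ*1/ℕ (k !) {{k ℕₚ.!≢0}})) (sym (fromℕ*1/ℕ r! {{r ℕₚ.!≢0}})) ⟩
    fromℕ (n C k) * ((fromℕ (k !) * expCoeff k) * (fromℕ r! * expCoeff r))
      ≡⟨ solve 5 (λ c a a⁻¹ b b⁻¹ → c :* ((a :* a⁻¹) :* (b :* b⁻¹)) := (c :* (a :* b)) :* (a⁻¹ :* b⁻¹))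
           refl (fromℕ (n C k)) (fromℕ (k !)) (expCoeff k) (fromℕ r!) (expCoeff r) ⟩
    (fromℕ (n C k) * (fromℕ (k !) * fromℕ r!)) * E
      ≡⟨ cong (λ x → (fromℕ (n C k) * x) * E) (sym (fromℕ-homo-* (k !) r!)) ⟩
    (fromℕ (n C k) * fromℕ (k ! ℕ.* r!)) * E          ≡⟨ cong (_* E) (sym (fromℕ-homo-* (n C k) (k ! ℕ.* r!))) ⟩
    fromℕ ((n C k) ℕ.* (k ! ℕ.* r!)) * E              ≡⟨ cong (λ x → fromℕ x * E) (nCk*[k!*[n∸k]!]≡n! k≤n) ⟩
    fromℕ (n !) * E                                   ∎
    where
    open ≡-Reasoning
    r : ℕ
    r = n ∸ k
    r! : ℕ
    r! = r !
    E : ℚ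
    E = expCoeff k * expCoeff r

  expCoeff*nCk : ∀ {n k} → k ≤ n → expCoeff n * fromℕ (n C k) ≡ expCoeff k * expCoeff (n ∸ k)
  expCoeff*nCk {n} {k} k≤n = begin
    expCoeff n * fromℕ (n C k)                 ≡⟨ cong (expCoeff n *_) (fromℕ-nCk k≤n) ⟩
    expCoeff n * (fromℕ (n !) * E)             ≡⟨ sym (ℚₚ.*-assoc (expCoeff n) (fromℕ (n !)) E) ⟩
    (expCoeff n * fromℕ (n !)) * E
      ≡⟨ cong (_* E) (trans (ℚₚ.*-comm (expCoeff n) (fromℕ (n !))) (fromℕ*1/ℕ (n !) {{n ℕₚ.!≢0}})) ⟩
    1ℚ * E                                     ≡⟨ ℚₚ.*-identityˡ E ⟩
    E                                          ∎
    where
    open ≡-Reasoning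
    E : ℚ
    E = expCoeff k * expCoeff (n ∸ k)

  nCk≤2^n : ∀ n k → n C k ≤ 2 ℕ.^ n
  nCk≤2^n zero    zero    = ℕₚ.≤-refl
  nCk≤2^n zero    (suc k) = ℕₚ.≤-trans (ℕₚ.≤-reflexive (k>n⇒nCk≡0 {0} {suc k} ℕ.z<s)) z≤n
  nCk≤2^n (suc n) zero    = ℕₚ.m^n>0 2 (suc n)
  nCk≤2^n (suc n) (suc k) = ℕₚ.≤-trans (ℕₚ.≤-reflexive (sym (nCk+nC[k+1]≡[n+1]C[k+1] n k)))
    (ℕₚ.+-mono-≤ (nCk≤2^n n k) (ℕₚ.≤-trans (nCk≤2^n n (suc k)) (ℕₚ.m≤m+n (2 ℕ.^ n) 0)))

module Decay where

  record Decays (K : ℕ) (u : ℕ → ℚ) : Set where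
    field
      nonNeg  : ∀ m → 0ℚ ℚ.≤ u m
      halving : ∀ m → K ≤ m → u (suc m) + u (suc m) ℚ.≤ u m

  module _ {K u} (decays : Decays K u) where

    open Decays decays
    open ℚₚ.≤-Reasoning

    u[1+m]≤u[m] : ∀ m → K ≤ m → u (suc m) ℚ.≤ u m
    u[1+m]≤u[m] m K≤m = ℚₚ.≤-trans (p≤q+p (nonNeg (suc m))) (halving m K≤m)

    antitone : ∀ {m m′} → K ≤ m → m ≤ m′ → u m′ ℚ.≤ u m
    antitone {m} K≤m m≤m′ with ℕₚ.m≤n⇒∃[o]m+o≡n m≤m′
    ... | d , refl = go d
      where
      go : ∀ d → u (m ℕ.+ d) ℚ.≤ u m
      go zero    = ℚₚ.≤-reflexive (cong u (ℕₚ.+-identityʳ m))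
      go (suc d) = begin
        u (m ℕ.+ suc d)    ≡⟨ cong u (ℕₚ.+-suc m d) ⟩
        u (suc (m ℕ.+ d))  ≤⟨ u[1+m]≤u[m] (m ℕ.+ d) (ℕₚ.≤-trans K≤m (ℕₚ.m≤m+n m d)) ⟩
        u (m ℕ.+ d)        ≤⟨ go d ⟩
        u m                ∎

    u[K+d]*[1+d]≤u[K] : ∀ d → u (K ℕ.+ d) * fromℕ (suc d) ℚ.≤ u K
    u[K+d]*[1+d]≤u[K] zero    = ℚₚ.≤-reflexive (trans (ℚₚ.*-identityʳ _) (cong u (ℕₚ.+-identityʳ K)))
    u[K+d]*[1+d]≤u[K] (suc d) = begin
      u (K ℕ.+ suc d) * fromℕ (2 ℕ.+ d)   ≡⟨ cong₂ _*_ (cong u (ℕₚ.+-suc K d)) (fromℕ-homo-+ 1 (suc d)) ⟩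
      v * (1ℚ + D)                        ≡⟨ trans (ℚₚ.*-distribˡ-+ v 1ℚ D) (cong (_+ v * D) (ℚₚ.*-identityʳ v)) ⟩
      v + v * D                           ≤⟨ ℚₚ.+-monoˡ-≤ (v * D) v≤v*D ⟩
      v * D + v * D                       ≡⟨ sym (ℚₚ.*-distribʳ-+ D v v) ⟩
      (v + v) * D                         ≤⟨ *-monoʳ-≤-nonNeg (0≤fromℕ (suc d)) (halving (K ℕ.+ d) (ℕₚ.m≤m+n K d)) ⟩
      u (K ℕ.+ d) * D                     ≤⟨ u[K+d]*[1+d]≤u[K] d ⟩
      u K                                 ∎
      where
      v : ℚ
      v = u (suc (K ℕ.+ d))
      D : ℚ
      D = fromℕ (suc d)
      v≤v*D : v ℚ.≤ v * D
      v≤v*D = ℚₚ.≤-trans (ℚₚ.≤-reflexive (sym (ℚₚ.*-identityʳ v)))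
                         (*-monoˡ-≤-nonNeg (nonNeg _) (fromℕ-mono-≤ {1} {suc d} (s≤s z≤n)))

    eventually-< : ∀ ε → 0ℚ < ε → ∃ λ N → ∀ m → N ≤ m → u m < ε
    eventually-< ε 0<ε = K ℕ.+ k , small
      where
      instance
        _ = ℚₚ.pos⇒nonZero ε {{ℚ.positive 0<ε}}
        _ = ℚ.positive 0<ε
      k : ℕ
      k = proj₁ (archimedean (u K * ℚ.1/ ε))
      uK<kε : u K < fromℕ k * ε
      uK<kε = subst (_< fromℕ k * ε)
        (trans (ℚₚ.*-assoc (u K) (ℚ.1/ ε) ε) (trans (cong (u K *_) (ℚₚ.*-inverseˡ ε)) (ℚₚ.*-identityʳ (u K))))
        (ℚₚ.*-monoˡ-<-pos ε (proj₂ (archimedean (u K * ℚ.1/ ε))))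
      small : ∀ m → K ℕ.+ k ≤ m → u m < ε
      small m K+k≤m with ℕₚ.m≤n⇒∃[o]m+o≡n K+k≤m
      ... | e , refl = ℚₚ.*-cancelʳ-<-nonNeg D {{ℚ.nonNegative (0≤fromℕ (suc d))}} (begin-strict
        u (K ℕ.+ k ℕ.+ e) * D  ≡⟨ cong (λ m → u m * D) (ℕₚ.+-assoc K k e) ⟩
        u (K ℕ.+ d) * D        ≤⟨ u[K+d]*[1+d]≤u[K] d ⟩
        u K                    <⟨ uK<kε ⟩
        fromℕ k * ε
          ≤⟨ *-monoʳ-≤-nonNeg (ℚₚ.<⇒≤ 0<ε) (fromℕ-mono-≤ (ℕₚ.≤-trans (ℕₚ.m≤m+n k e) (ℕₚ.n≤1+n d))) ⟩
        D * ε                  ≡⟨ ℚₚ.*-comm D ε ⟩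
        ε * D                  ∎)
        where
        d : ℕ
        d = k ℕ.+ e
        D : ℚ
        D = fromℕ (suc d)

  *-decays : ∀ {K u c} → 0ℚ ℚ.≤ c → Decays K u → Decays K (λ m → c * u m)
  *-decays {u = u} {c} 0≤c decays = record
    { nonNeg  = λ m → nonNeg*nonNeg⇒nonNeg 0≤c (nonNeg m)
    ; halving = λ m K≤m → ℚₚ.≤-trans (ℚₚ.≤-reflexive (sym (ℚₚ.*-distribˡ-+ c (u (suc m)) (u (suc m)))))
                                      (*-monoˡ-≤-nonNeg 0≤c (halving m K≤m))
    }
    where open Decays decays

module Exponential where

  open FiniteSum
  open Binomial
  open Decay

  expTerm : ℚ → ℕ → ℚ
  expTerm x m = x ^ m * expCoeff m

  expTerm-+ : ∀ x i j → expTerm x (i ℕ.+ j) * fromℕ ((i ℕ.+ j) C i) ≡ expTerm x i * expTerm x j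
  expTerm-+ x i j = begin
    (x ^ (i ℕ.+ j) * expCoeff (i ℕ.+ j)) * fromℕ ((i ℕ.+ j) C i)   ≡⟨ ℚₚ.*-assoc (x ^ (i ℕ.+ j)) _ _ ⟩
    x ^ (i ℕ.+ j) * (expCoeff (i ℕ.+ j) * fromℕ ((i ℕ.+ j) C i))
      ≡⟨ cong₂ _*_ (^-homo-* x i j) (expCoeff*nCk (ℕₚ.m≤m+n i j)) ⟩
    (x ^ i * x ^ j) * (expCoeff i * expCoeff (i ℕ.+ j ∸ i))
      ≡⟨ cong (λ r → (x ^ i * x ^ j) * (expCoeff i * expCoeff r)) (ℕₚ.m+n∸m≡n i j) ⟩
    (x ^ i * x ^ j) * (expCoeff i * expCoeff j)
      ≡⟨ solve 4 (λ a b c d → (a :* b) :* (c :* d) := (a :* c) :* (b :* d)) refl (x ^ i) (x ^ j) (expCoeff i) (expCoeff j) ⟩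
    expTerm x i * expTerm x j                                       ∎
    where open ≡-Reasoning

  Σ<-expTerm*C : ∀ x i N (f : ℕ → ℚ) →
                 Σ< (i ℕ.+ N) (λ m → expTerm x m * fromℕ (m C i) * f m) ≡
                 expTerm x i * Σ< N (λ j → expTerm x j * f (i ℕ.+ j))
  Σ<-expTerm*C x i N f = begin
    Σ< (i ℕ.+ N) g                                         ≡⟨ Σ<-+ i N g ⟩
    Σ< i g + Σ< N (λ j → g (i ℕ.+ j))                       ≡⟨ cong (_+ Σ< N (λ j → g (i ℕ.+ j))) (Σ<-zero i g≡0) ⟩
    0ℚ + Σ< N (λ j → g (i ℕ.+ j))                           ≡⟨ ℚₚ.+-identityˡ _ ⟩
    Σ< N (λ j → g (i ℕ.+ j))                                ≡⟨ Σ<-cong N (λ j _ → shift j) ⟩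
    Σ< N (λ j → expTerm x i * (expTerm x j * f (i ℕ.+ j)))  ≡⟨ sym (*-distribˡ-Σ< N (expTerm x i) _) ⟩
    expTerm x i * Σ< N (λ j → expTerm x j * f (i ℕ.+ j))    ∎
    where
    open ≡-Reasoning
    g : ℕ → ℚ
    g m = expTerm x m * fromℕ (m C i) * f m
    g≡0 : ∀ k → k ℕ.< i → g k ≡ 0ℚ
    g≡0 k k<i = begin
      expTerm x k * fromℕ (k C i) * f k  ≡⟨ cong (λ c → expTerm x k * fromℕ c * f k) (k>n⇒nCk≡0 k<i) ⟩
      expTerm x k * 0ℚ * f k             ≡⟨ cong (_* f k) (ℚₚ.*-zeroʳ (expTerm x k)) ⟩
      0ℚ * f k                           ≡⟨ ℚₚ.*-zeroˡ (f k) ⟩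
      0ℚ                                 ∎
    shift : ∀ j → g (i ℕ.+ j) ≡ expTerm x i * (expTerm x j * f (i ℕ.+ j))
    shift j = trans (cong (_* f (i ℕ.+ j)) (expTerm-+ x i j)) (ℚₚ.*-assoc (expTerm x i) (expTerm x j) (f (i ℕ.+ j)))

  expTerm-suc : ∀ x m → expTerm x (suc m) ≡ (x * 1/ℕ (suc m)) * expTerm x m
  expTerm-suc x m = begin
    (x * x ^ m) * expCoeff (suc m)               ≡⟨ cong ((x * x ^ m) *_) (1/ℕ-homo-* (suc m) (m !)) ⟩
    (x * x ^ m) * (1/ℕ (suc m) * expCoeff m)
      ≡⟨ solve 4 (λ x y i e → (x :* y) :* (i :* e) := (x :* i) :* (y :* e)) refl x (x ^ m) (1/ℕ (suc m)) (expCoeff m) ⟩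
    (x * 1/ℕ (suc m)) * expTerm x m              ∎
    where
    open ≡-Reasoning
    instance _ = m ℕₚ.!≢0

  expTerm-decays : ∀ c → Decays (2 ℕ.* c) (expTerm (fromℕ c))
  expTerm-decays c = record { nonNeg = nonNeg ; halving = halving }
    where
    x : ℚ
    x = fromℕ c
    nonNeg : ∀ m → 0ℚ ℚ.≤ expTerm x m
    nonNeg m = subst (λ y → 0ℚ ℚ.≤ y * expCoeff m) (fromℕ-homo-^ c m)
                     (nonNeg*nonNeg⇒nonNeg (0≤fromℕ (c ℕ.^ m)) (0≤1/ℕ (m !) {{m ℕₚ.!≢0}}))
    halving : ∀ m → 2 ℕ.* c ≤ m → expTerm x (suc m) + expTerm x (suc m) ℚ.≤ expTerm x m
    halving m 2c≤m = begin
      expTerm x (suc m) + expTerm x (suc m)   ≡⟨ cong (λ v → v + v) (expTerm-suc x m) ⟩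
      (x * I) * w + (x * I) * w
        ≡⟨ solve 3 (λ x i w → (x :* i) :* w :+ (x :* i) :* w := ((con (fromℕ 2) :* x) :* i) :* w) refl x I w ⟩
      ((fromℕ 2 * x) * I) * w                 ≡⟨ cong (λ y → (y * I) * w) (sym (fromℕ-homo-* 2 c)) ⟩
      (fromℕ (2 ℕ.* c) * I) * w
        ≤⟨ *-monoʳ-≤-nonNeg (nonNeg m) (*-monoʳ-≤-nonNeg (0≤1/ℕ (suc m)) (fromℕ-mono-≤ (ℕₚ.m≤n⇒m≤1+n 2c≤m))) ⟩
      (fromℕ (suc m) * I) * w                 ≡⟨ cong (_* w) (fromℕ*1/ℕ (suc m)) ⟩
      1ℚ * w                                  ≡⟨ ℚₚ.*-identityˡ w ⟩
      w                                       ∎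
      where
      open ℚₚ.≤-Reasoning
      I : ℚ
      I = 1/ℕ (suc m)
      w : ℚ
      w = expTerm x m

module Difference where

  open FiniteSum

  -- Δ N g j is (-1)ᴺ times the N-th forward difference of g at j.
  Δ : ℕ → (ℕ → ℚ) → ℕ → ℚ
  Δ N g j = Σ< (suc N) (λ k → fromℕ (N C k) * (- 1ℚ) ^ k * g (k ℕ.+ j))

  Δ-suc : ∀ N g j → Δ (suc N) g j ≡ Δ N g j - Δ N g (suc j)
  Δ-suc N g j = begin
    Σ< (2 ℕ.+ N) h′                                             ≡⟨ Σ<-head (suc N) h′ ⟩
    h 0 + Σ< (suc N) (λ k → h′ (suc k))
      ≡⟨ cong (_+_ (h 0)) (Σ<-cong (suc N) (λ k _ → pascal k)) ⟩
    h 0 + Σ< (suc N) (λ k → h (suc k) + - h₊ k)                  ≡⟨ cong (_+_ (h 0)) (Σ<-distrib-+ (suc N) _ _) ⟩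
    h 0 + (Σ< (suc N) (λ k → h (suc k)) + Σ< (suc N) (λ k → - h₊ k))
      ≡⟨ cong (λ t → h 0 + (Σ< (suc N) (λ k → h (suc k)) + t)) (sym (Σ<-neg (suc N) h₊)) ⟩
    h 0 + (Σ< (suc N) (λ k → h (suc k)) - Δ N g (suc j))         ≡⟨ sym (ℚₚ.+-assoc (h 0) _ _) ⟩
    (h 0 + Σ< (suc N) (λ k → h (suc k))) - Δ N g (suc j)         ≡⟨ cong (_- Δ N g (suc j)) (sym (Σ<-head (suc N) h)) ⟩
    (Δ N g j + h (suc N)) - Δ N g (suc j)
      ≡⟨ cong (λ t → (Δ N g j + t) - Δ N g (suc j)) h[1+N]≡0 ⟩
    (Δ N g j + 0ℚ) - Δ N g (suc j)                               ≡⟨ cong (_- Δ N g (suc j)) (ℚₚ.+-identityʳ (Δ N g j)) ⟩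
    Δ N g j - Δ N g (suc j)                                      ∎
    where
    open ≡-Reasoning
    s : ℚ
    s = - 1ℚ
    h′ h h₊ : ℕ → ℚ
    h′ k = fromℕ (suc N C k) * s ^ k * g (k ℕ.+ j)
    h  k = fromℕ (N C k) * s ^ k * g (k ℕ.+ j)
    h₊ k = fromℕ (N C k) * s ^ k * g (k ℕ.+ suc j)
    h[1+N]≡0 : h (suc N) ≡ 0ℚ
    h[1+N]≡0 = begin
      fromℕ (N C suc N) * s ^ suc N * g (suc N ℕ.+ j)
        ≡⟨ cong (λ c → fromℕ c * s ^ suc N * g (suc N ℕ.+ j)) (k>n⇒nCk≡0 (ℕₚ.n<1+n N)) ⟩
      0ℚ * s ^ suc N * g (suc N ℕ.+ j)                  ≡⟨ cong (_* g (suc N ℕ.+ j)) (ℚₚ.*-zeroˡ (s ^ suc N)) ⟩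
      0ℚ * g (suc N ℕ.+ j)                              ≡⟨ ℚₚ.*-zeroˡ (g (suc N ℕ.+ j)) ⟩
      0ℚ                                                ∎
    pascal : ∀ k → h′ (suc k) ≡ h (suc k) + - h₊ k
    pascal k = begin
      fromℕ (suc N C suc k) * (s * s ^ k) * G
        ≡⟨ cong (λ c → fromℕ c * (s * s ^ k) * G) (sym (nCk+nC[k+1]≡[n+1]C[k+1] N k)) ⟩
      fromℕ (N C k ℕ.+ N C suc k) * (s * s ^ k) * G
        ≡⟨ cong (λ c → c * (s * s ^ k) * G) (fromℕ-homo-+ (N C k) (N C suc k)) ⟩
      (fromℕ (N C k) + fromℕ (N C suc k)) * (s * s ^ k) * G
        ≡⟨ solve 4 (λ a b t G → (a :+ b) :* ((:- con 1ℚ) :* t) :* G := b :* ((:- con 1ℚ) :* t) :* G :+ (:- (a :* t :* G)))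
                 refl (fromℕ (N C k)) (fromℕ (N C suc k)) (s ^ k) G ⟩
      h (suc k) + - (fromℕ (N C k) * s ^ k * G)
        ≡⟨ cong (λ i → h (suc k) + - (fromℕ (N C k) * s ^ k * g i)) (sym (ℕₚ.+-suc k j)) ⟩
      h (suc k) + - h₊ k                                        ∎
      where
      G : ℚ
      G = g (suc k ℕ.+ j)

  C[_] : ℕ → ℕ → ℚ
  C[ k ] m = fromℕ (m C k)

  Δ-C-top : ∀ N j i → Δ N C[ i ℕ.+ N ] j ≡ (- 1ℚ) ^ N * fromℕ (j C i)
  Δ-C-top zero    j i = trans (ℚₚ.+-identityˡ _) (cong (λ t → 1ℚ * fromℕ (j C t)) (ℕₚ.+-identityʳ i))
  Δ-C-top (suc N) j i = begin
    Δ (suc N) C[ i ℕ.+ suc N ] j                                  ≡⟨ Δ-suc N C[ i ℕ.+ suc N ] j ⟩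
    Δ N C[ i ℕ.+ suc N ] j - Δ N C[ i ℕ.+ suc N ] (suc j)
      ≡⟨ cong (λ k → Δ N C[ k ] j - Δ N C[ k ] (suc j)) (ℕₚ.+-suc i N) ⟩
    Δ N C[ suc i ℕ.+ N ] j - Δ N C[ suc i ℕ.+ N ] (suc j)
      ≡⟨ cong₂ _-_ (Δ-C-top N j (suc i)) (Δ-C-top N (suc j) (suc i)) ⟩
    σ * fromℕ (j C suc i) - σ * fromℕ (suc j C suc i)
      ≡⟨ cong (λ c → σ * fromℕ (j C suc i) - σ * fromℕ c) (sym (nCk+nC[k+1]≡[n+1]C[k+1] j i)) ⟩
    σ * fromℕ (j C suc i) - σ * fromℕ (j C i ℕ.+ j C suc i)
      ≡⟨ cong (λ c → σ * fromℕ (j C suc i) - σ * c) (fromℕ-homo-+ (j C i) (j C suc i)) ⟩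
    σ * fromℕ (j C suc i) - σ * (fromℕ (j C i) + fromℕ (j C suc i))
      ≡⟨ solve 3 (λ σ a b → σ :* b :- σ :* (a :+ b) := ((:- con 1ℚ) :* σ) :* a) refl σ (fromℕ (j C i)) (fromℕ (j C suc i)) ⟩
    (- 1ℚ * σ) * fromℕ (j C i)                                    ∎
    where
    open ≡-Reasoning
    σ : ℚ
    σ = (- 1ℚ) ^ N

  Δ-C-low : ∀ N j i → i ℕ.< N → Δ N C[ i ] j ≡ 0ℚ
  Δ-C-low (suc N) j i i<1+N with ℕₚ.m<1+n⇒m<n∨m≡n i<1+N
  ... | inj₁ i<N = begin
    Δ (suc N) C[ i ] j                ≡⟨ Δ-suc N C[ i ] j ⟩
    Δ N C[ i ] j - Δ N C[ i ] (suc j) ≡⟨ cong₂ _-_ (Δ-C-low N j i i<N) (Δ-C-low N (suc j) i i<N) ⟩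
    0ℚ - 0ℚ                           ≡⟨ ℚₚ.+-inverseʳ 0ℚ ⟩
    0ℚ                                ∎
    where open ≡-Reasoning
  ... | inj₂ refl = begin
    Δ (suc N) C[ N ] j                ≡⟨ Δ-suc N C[ N ] j ⟩
    Δ N C[ N ] j - Δ N C[ N ] (suc j) ≡⟨ cong₂ _-_ (Δ-C-top N j 0) (Δ-C-top N (suc j) 0) ⟩
    σ * 1ℚ - σ * 1ℚ                   ≡⟨ ℚₚ.+-inverseʳ (σ * 1ℚ) ⟩
    0ℚ                                ∎
    where
    open ≡-Reasoning
    σ : ℚ
    σ = (- 1ℚ) ^ N

  Δ-linear : ∀ N L (c : ℕ → ℚ) (h : ℕ → ℕ → ℚ) j →
             Δ N (λ m → Σ< L (λ i → c i * h i m)) j ≡ Σ< L (λ i → c i * Δ N (h i) j)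
  Δ-linear N L c h j = begin
    Σ< (suc N) (λ k → a k * Σ< L (λ i → c i * h i (k ℕ.+ j)))
      ≡⟨ Σ<-cong (suc N) (λ k _ → *-distribˡ-Σ< L (a k) _) ⟩
    Σ< (suc N) (λ k → Σ< L (λ i → a k * (c i * h i (k ℕ.+ j))))      ≡⟨ Σ<-comm (suc N) L _ ⟩
    Σ< L (λ i → Σ< (suc N) (λ k → a k * (c i * h i (k ℕ.+ j))))
      ≡⟨ Σ<-cong L (λ i _ → Σ<-cong (suc N) (λ k _ → swap (a k) (c i) _)) ⟩
    Σ< L (λ i → Σ< (suc N) (λ k → c i * (a k * h i (k ℕ.+ j))))
      ≡⟨ Σ<-cong L (λ i _ → sym (*-distribˡ-Σ< (suc N) (c i) _)) ⟩
    Σ< L (λ i → c i * Δ N (h i) j)                                   ∎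
    where
    open ≡-Reasoning
    a : ℕ → ℚ
    a k = fromℕ (N C k) * (- 1ℚ) ^ k
    swap : ∀ x y z → x * (y * z) ≡ y * (x * z)
    swap x y z = solve 3 (λ x y z → x :* (y :* z) := y :* (x :* z)) refl x y z

polyPowCoeff*[-n]^k : ∀ n m k → fromℤ (polyPowCoeff n m k) * (- fromℕ n) ^ k ≡ fromℕ (m C k) * (- fromℕ n) ^ m
polyPowCoeff*[-n]^k n zero    zero    = refl
polyPowCoeff*[-n]^k n zero    (suc k) = begin
  0ℚ * (- fromℕ n) ^ suc k   ≡⟨ ℚₚ.*-zeroˡ ((- fromℕ n) ^ suc k) ⟩
  0ℚ                         ≡⟨ cong fromℕ (sym (k>n⇒nCk≡0 {0} {suc k} ℕ.z<s)) ⟩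
  fromℕ (0 C suc k)          ≡⟨ sym (ℚₚ.*-identityʳ (fromℕ (0 C suc k))) ⟩
  fromℕ (0 C suc k) * 1ℚ     ∎
  where open ≡-Reasoning
polyPowCoeff*[-n]^k n (suc m) zero    = begin
  fromℤ (ℤ.- (+ n ℤ.* P)) * 1ℚ     ≡⟨ cong (_* 1ℚ) (trans (fromℤ-homo‿- (+ n ℤ.* P)) (cong -_ (fromℤ-homo-* (+ n) P))) ⟩
  - (x * fromℤ P) * 1ℚ
    ≡⟨ solve 2 (λ x p → :- (x :* p) :* con 1ℚ := (:- x) :* (p :* con 1ℚ)) refl x (fromℤ P) ⟩
  - x * (fromℤ P * 1ℚ)             ≡⟨ cong (- x *_) (polyPowCoeff*[-n]^k n m zero) ⟩
  - x * (1ℚ * (- x) ^ m)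
    ≡⟨ solve 2 (λ x y → (:- x) :* (con 1ℚ :* y) := con 1ℚ :* ((:- x) :* y)) refl x ((- x) ^ m) ⟩
  1ℚ * (- x) ^ suc m               ∎
  where
  open ≡-Reasoning
  x : ℚ
  x = fromℕ n
  P : ℤ
  P = polyPowCoeff n m zero
polyPowCoeff*[-n]^k n (suc m) (suc k) = begin
  fromℤ (P ℤ.- + n ℤ.* P₊) * (- x * (- x) ^ k)
    ≡⟨ cong (_* (- x * (- x) ^ k)) (trans (fromℤ-homo-+ P (ℤ.- (+ n ℤ.* P₊)))
         (cong (_+_ (fromℤ P)) (trans (fromℤ-homo‿- (+ n ℤ.* P₊)) (cong -_ (fromℤ-homo-* (+ n) P₊))))) ⟩
  (fromℤ P - x * fromℤ P₊) * (- x * (- x) ^ k)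
    ≡⟨ solve 4 (λ a b x y → (a :- x :* b) :* ((:- x) :* y) := (:- x) :* (a :* y) :+ (:- x) :* (b :* ((:- x) :* y)))
             refl (fromℤ P) (fromℤ P₊) x ((- x) ^ k) ⟩
  - x * (fromℤ P * (- x) ^ k) + - x * (fromℤ P₊ * (- x) ^ suc k)
    ≡⟨ cong₂ (λ a b → - x * a + - x * b) (polyPowCoeff*[-n]^k n m k) (polyPowCoeff*[-n]^k n m (suc k)) ⟩
  - x * (fromℕ (m C k) * (- x) ^ m) + - x * (fromℕ (m C suc k) * (- x) ^ m)
    ≡⟨ solve 4 (λ a b x z → (:- x) :* (a :* z) :+ (:- x) :* (b :* z) := (a :+ b) :* ((:- x) :* z))
             refl (fromℕ (m C k)) (fromℕ (m C suc k)) x ((- x) ^ m) ⟩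
  (fromℕ (m C k) + fromℕ (m C suc k)) * (- x) ^ suc m
    ≡⟨ cong (_* (- x) ^ suc m) (trans (sym (fromℕ-homo-+ (m C k) (m C suc k))) (cong fromℕ (nCk+nC[k+1]≡[n+1]C[k+1] m k))) ⟩
  fromℕ (suc m C suc k) * (- x) ^ suc m   ∎
  where
  open ≡-Reasoning
  x  = fromℕ n
  P : ℤ
  P = polyPowCoeff n m k
  P₊ : ℤ
  P₊ = polyPowCoeff n m (suc k)

module Series (n : ℕ) .{{_ : NonZero n}} where

  open FiniteSum
  open Binomial
  open Exponential
  open Difference
  open Decay

  x : ℚ
  x = fromℕ n

  coeff : ℕ → ℚ
  coeff i = fromℕ (n !) * expCoeff (n ∸ i) * (- 1/ℕ n) ^ i

  p : ℕ → ℚ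
  p m = Σ< (suc n) (λ i → coeff i * C[ i ] m)

  instance
    nⁿ≢0 : NonZero (n ℕ.^ n)
    nⁿ≢0 = ℕₚ.m^n≢0 n n

  κ : ℚ
  κ = fromℕ (n !) * 1/ℕ (n ℕ.^ n)

  polyPowCoeff≡ : ∀ m k → fromℤ (polyPowCoeff n m k) ≡ fromℕ (m C k) * (- x) ^ m * (- 1/ℕ n) ^ k
  polyPowCoeff≡ m k = begin
    P                                          ≡⟨ sym (ℚₚ.*-identityʳ P) ⟩
    P * 1ℚ                                     ≡⟨ cong (P *_) (sym (1^n≡1 k)) ⟩
    P * 1ℚ ^ k
      ≡⟨ cong (λ y → P * y ^ k) (sym (trans (solve 2 (λ x y → (:- x) :* (:- y) := x :* y) refl x (1/ℕ n)) (fromℕ*1/ℕ n))) ⟩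
    P * (- x * - 1/ℕ n) ^ k                    ≡⟨ cong (P *_) (^-distrib-* (- x) (- 1/ℕ n) k) ⟩
    P * ((- x) ^ k * (- 1/ℕ n) ^ k)            ≡⟨ sym (ℚₚ.*-assoc P _ _) ⟩
    P * (- x) ^ k * (- 1/ℕ n) ^ k              ≡⟨ cong (_* (- 1/ℕ n) ^ k) (polyPowCoeff*[-n]^k n m k) ⟩
    fromℕ (m C k) * (- x) ^ m * (- 1/ℕ n) ^ k  ∎
    where
    open ≡-Reasoning
    P : ℚ
    P = fromℤ (polyPowCoeff n m k)

  τ≡[-n]^m*p : ∀ m → τ m n ≡ (- x) ^ m * p m
  τ≡[-n]^m*p m = begin
    fromℕ (n !) * Σ< (suc n) (λ k → fromℤ (polyPowCoeff n m k) * expCoeff (n ∸ k))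
      ≡⟨ cong (fromℕ (n !) *_) (Σ<-cong (suc n) (λ k _ → cong (_* expCoeff (n ∸ k)) (polyPowCoeff≡ m k))) ⟩
    fromℕ (n !) * Σ< (suc n) (λ k → fromℕ (m C k) * (- x) ^ m * (- 1/ℕ n) ^ k * expCoeff (n ∸ k))
      ≡⟨ *-distribˡ-Σ< (suc n) (fromℕ (n !)) _ ⟩
    Σ< (suc n) (λ k → fromℕ (n !) * (fromℕ (m C k) * (- x) ^ m * (- 1/ℕ n) ^ k * expCoeff (n ∸ k)))
      ≡⟨ Σ<-cong (suc n) (λ k _ → solve 5 (λ f c y z e → f :* (c :* y :* z :* e) := y :* (f :* e :* z :* c))
                                           refl (fromℕ (n !)) (fromℕ (m C k)) ((- x) ^ m) ((- 1/ℕ n) ^ k) (expCoeff (n ∸ k))) ⟩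
    Σ< (suc n) (λ k → (- x) ^ m * (coeff k * fromℕ (m C k)))
      ≡⟨ sym (*-distribˡ-Σ< (suc n) ((- x) ^ m) _) ⟩
    (- x) ^ m * p m
      ∎
    where open ≡-Reasoning

  lhsTerm≡expTerm*p² : ∀ m → lhsTerm n m ≡ expTerm x m * (p m * p m)
  lhsTerm≡expTerm*p² m = begin
    τ m n * τ m n * 1/ℕ (m ! ℕ.* n ℕ.^ m) {{nz}}
      ≡⟨ cong₂ (λ t d → t * t * d) (τ≡[-n]^m*p m)
               (trans (1/ℕ-homo-* (m !) (n ℕ.^ m)) (cong (expCoeff m *_) (1/ℕ-homo-^ n m))) ⟩
    ((- x) ^ m * p m) * ((- x) ^ m * p m) * (expCoeff m * 1/ℕ n ^ m)
      ≡⟨ solve 4 (λ y q e i → (y :* q) :* (y :* q) :* (e :* i) := ((y :* y) :* i) :* e :* (q :* q))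
               refl ((- x) ^ m) (p m) (expCoeff m) (1/ℕ n ^ m) ⟩
    ((- x) ^ m * (- x) ^ m * 1/ℕ n ^ m) * expCoeff m * (p m * p m)
      ≡⟨ cong (λ y → y * expCoeff m * (p m * p m)) [-x]^m*[-x]^m*[1/n]^m≡x^m ⟩
    expTerm x m * (p m * p m)
      ∎
    where
    open ≡-Reasoning
    instance
      _ = m ℕₚ.!≢0
      _ = ℕₚ.m^n≢0 n m
    nz : NonZero (m ! ℕ.* n ℕ.^ m)
    nz = ℕₚ.m*n≢0 (m !) (n ℕ.^ m)
    [-x]^m*[-x]^m*[1/n]^m≡x^m : (- x) ^ m * (- x) ^ m * 1/ℕ n ^ m ≡ x ^ m
    [-x]^m*[-x]^m*[1/n]^m≡x^m = begin
      (- x) ^ m * (- x) ^ m * 1/ℕ n ^ m   ≡⟨ cong (_* 1/ℕ n ^ m) (sym (^-distrib-* (- x) (- x) m)) ⟩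
      (- x * - x) ^ m * 1/ℕ n ^ m         ≡⟨ sym (^-distrib-* (- x * - x) (1/ℕ n) m) ⟩
      (- x * - x * 1/ℕ n) ^ m
        ≡⟨ cong (_^ m) (solve 2 (λ x i → (:- x) :* (:- x) :* i := x :* (x :* i)) refl x (1/ℕ n)) ⟩
      (x * (x * 1/ℕ n)) ^ m               ≡⟨ cong (λ y → (x * y) ^ m) (fromℕ*1/ℕ n) ⟩
      (x * 1ℚ) ^ m                        ≡⟨ cong (_^ m) (ℚₚ.*-identityʳ x) ⟩
      x ^ m                               ∎

  rhsTerm≡κ*expTerm : ∀ k → rhsTerm n k ≡ κ * expTerm x k
  rhsTerm≡κ*expTerm k = begin
    (+ (n ! ℕ.* n ℕ.^ k) / (n ℕ.^ n ℕ.* k !)) {{nz}}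
      ≡⟨ /-as-* (+ (n ! ℕ.* n ℕ.^ k)) (n ℕ.^ n ℕ.* k !) {{nz}} ⟩
    fromℕ (n ! ℕ.* n ℕ.^ k) * 1/ℕ (n ℕ.^ n ℕ.* k !) {{nz}}
      ≡⟨ cong₂ _*_ (trans (fromℕ-homo-* (n !) (n ℕ.^ k)) (cong (fromℕ (n !) *_) (fromℕ-homo-^ n k)))
                   (1/ℕ-homo-* (n ℕ.^ n) (k !)) ⟩
    (fromℕ (n !) * x ^ k) * (1/ℕ (n ℕ.^ n) * expCoeff k)
      ≡⟨ solve 4 (λ a b c d → (a :* b) :* (c :* d) := (a :* c) :* (b :* d))
               refl (fromℕ (n !)) (x ^ k) (1/ℕ (n ℕ.^ n)) (expCoeff k) ⟩
    κ * expTerm x k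
      ∎
    where
    open ≡-Reasoning
    instance _ = k ℕₚ.!≢0
    nz : NonZero (n ℕ.^ n ℕ.* k !)
    nz = ℕₚ.m*n≢0 (n ℕ.^ n) (k !)

  coeff*expTerm : ∀ i → i ≤ n → coeff i * expTerm x i ≡ fromℕ (n C i) * (- 1ℚ) ^ i
  coeff*expTerm i i≤n = begin
    fromℕ (n !) * expCoeff (n ∸ i) * (- 1/ℕ n) ^ i * (x ^ i * expCoeff i)
      ≡⟨ solve 5 (λ f e y z e′ → f :* e :* y :* (z :* e′) := f :* (e′ :* e) :* (y :* z))
               refl (fromℕ (n !)) (expCoeff (n ∸ i)) ((- 1/ℕ n) ^ i) (x ^ i) (expCoeff i) ⟩
    fromℕ (n !) * (expCoeff i * expCoeff (n ∸ i)) * ((- 1/ℕ n) ^ i * x ^ i)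
      ≡⟨ cong₂ _*_ (sym (fromℕ-nCk i≤n)) (sym (^-distrib-* (- 1/ℕ n) x i)) ⟩
    fromℕ (n C i) * (- 1/ℕ n * x) ^ i
      ≡⟨ cong (λ y → fromℕ (n C i) * y ^ i)
              (trans (solve 2 (λ i x → (:- i) :* x := :- (x :* i)) refl (1/ℕ n) x) (cong -_ (fromℕ*1/ℕ n))) ⟩
    fromℕ (n C i) * (- 1ℚ) ^ i
      ∎
    where open ≡-Reasoning

  Δp≡κ : ∀ j → Δ n p j ≡ κ
  Δp≡κ j = begin
    Δ n p j                                               ≡⟨ Δ-linear n (suc n) coeff C[_] j ⟩
    Σ< n (λ i → coeff i * Δ n C[ i ] j) + coeff n * Δ n C[ n ] j
      ≡⟨ cong₂ _+_ (Σ<-zero n (λ i i<n → trans (cong (coeff i *_) (Δ-C-low n j i i<n)) (ℚₚ.*-zeroʳ (coeff i))))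
                   (cong (coeff n *_) (Δ-C-top n j 0)) ⟩
    0ℚ + coeff n * ((- 1ℚ) ^ n * 1ℚ)                      ≡⟨ ℚₚ.+-identityˡ _ ⟩
    coeff n * ((- 1ℚ) ^ n * 1ℚ)
      ≡⟨ cong (λ r → fromℕ (n !) * expCoeff r * (- 1/ℕ n) ^ n * ((- 1ℚ) ^ n * 1ℚ)) (ℕₚ.n∸n≡0 n) ⟩
    fromℕ (n !) * 1ℚ * (- 1/ℕ n) ^ n * ((- 1ℚ) ^ n * 1ℚ)
      ≡⟨ solve 3 (λ f y s → f :* con 1ℚ :* y :* (s :* con 1ℚ) := f :* (y :* s)) refl (fromℕ (n !)) ((- 1/ℕ n) ^ n) ((- 1ℚ) ^ n) ⟩
    fromℕ (n !) * ((- 1/ℕ n) ^ n * (- 1ℚ) ^ n)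
      ≡⟨ cong (fromℕ (n !) *_) (sym (^-distrib-* (- 1/ℕ n) (- 1ℚ) n)) ⟩
    fromℕ (n !) * (- 1/ℕ n * - 1ℚ) ^ n
      ≡⟨ cong (λ y → fromℕ (n !) * y ^ n) (solve 1 (λ i → (:- i) :* (:- con 1ℚ) := i) refl (1/ℕ n)) ⟩
    fromℕ (n !) * 1/ℕ n ^ n                               ≡⟨ cong (fromℕ (n !) *_) (sym (1/ℕ-homo-^ n n)) ⟩
    κ                                                     ∎
    where open ≡-Reasoning

  term : ℕ → ℕ → ℚ
  term i m = expTerm x m * fromℕ (m C i) * p m

  tail₁ tail₂ : ℕ → ℚ
  tail₁ N = Σ< (suc n) (λ i → coeff i * Σ< (n ∸ i) (λ t → term i (i ℕ.+ N ℕ.+ t)))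
  tail₂ N = Σ< n (λ t → κ * expTerm x (N ℕ.+ t))

  Σ<-rhsTerm : ∀ N → Σ< (N ℕ.+ n) (rhsTerm n) ≡ κ * Σ< N (expTerm x) + tail₂ N
  Σ<-rhsTerm N = begin
    Σ< (N ℕ.+ n) (rhsTerm n)                        ≡⟨ Σ<-cong (N ℕ.+ n) (λ k _ → rhsTerm≡κ*expTerm k) ⟩
    Σ< (N ℕ.+ n) (λ k → κ * expTerm x k)            ≡⟨ Σ<-+ N n _ ⟩
    Σ< N (λ k → κ * expTerm x k) + tail₂ N          ≡⟨ cong (_+ tail₂ N) (sym (*-distribˡ-Σ< N κ (expTerm x))) ⟩
    κ * Σ< N (expTerm x) + tail₂ N                  ∎
    where open ≡-Reasoning

  Σ<-term : ∀ N i → i ≤ n →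
            Σ< (N ℕ.+ n) (term i) ≡
            expTerm x i * Σ< N (λ j → expTerm x j * p (i ℕ.+ j)) + Σ< (n ∸ i) (λ t → term i (i ℕ.+ N ℕ.+ t))
  Σ<-term N i i≤n = begin
    Σ< (N ℕ.+ n) (term i)                       ≡⟨ cong (λ M → Σ< M (term i)) N+n≡i+N+[n∸i] ⟩
    Σ< (i ℕ.+ N ℕ.+ (n ∸ i)) (term i)           ≡⟨ Σ<-+ (i ℕ.+ N) (n ∸ i) (term i) ⟩
    Σ< (i ℕ.+ N) (term i) + R                   ≡⟨ cong (_+ R) (Σ<-expTerm*C x i N p) ⟩
    expTerm x i * Σ< N (λ j → expTerm x j * p (i ℕ.+ j)) + R ∎
    where
    open ≡-Reasoning
    R : ℚ
    R = Σ< (n ∸ i) (λ t → term i (i ℕ.+ N ℕ.+ t))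
    N+n≡i+N+[n∸i] : N ℕ.+ n ≡ i ℕ.+ N ℕ.+ (n ∸ i)
    N+n≡i+N+[n∸i] = begin
      N ℕ.+ n                 ≡⟨ cong (N ℕ.+_) (sym (ℕₚ.m+[n∸m]≡n i≤n)) ⟩
      N ℕ.+ (i ℕ.+ (n ∸ i))   ≡⟨ sym (ℕₚ.+-assoc N i (n ∸ i)) ⟩
      N ℕ.+ i ℕ.+ (n ∸ i)     ≡⟨ cong (ℕ._+ (n ∸ i)) (ℕₚ.+-comm N i) ⟩
      i ℕ.+ N ℕ.+ (n ∸ i)     ∎

  Σ<-alternating : ∀ N →
                   Σ< (suc n) (λ i → fromℕ (n C i) * (- 1ℚ) ^ i * Σ< N (λ j → expTerm x j * p (i ℕ.+ j))) ≡
                   κ * Σ< N (expTerm x)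
  Σ<-alternating N = begin
    Σ< (suc n) (λ i → a i * Σ< N (λ j → expTerm x j * p (i ℕ.+ j)))
      ≡⟨ Σ<-cong (suc n) (λ i _ → *-distribˡ-Σ< N (a i) _) ⟩
    Σ< (suc n) (λ i → Σ< N (λ j → a i * (expTerm x j * p (i ℕ.+ j))))
      ≡⟨ Σ<-comm (suc n) N _ ⟩
    Σ< N (λ j → Σ< (suc n) (λ i → a i * (expTerm x j * p (i ℕ.+ j))))
      ≡⟨ Σ<-cong N (λ j _ → Σ<-cong (suc n) (λ i _ → solve 3 (λ a e q → a :* (e :* q) := e :* (a :* q))
           refl (a i) (expTerm x j) (p (i ℕ.+ j)))) ⟩
    Σ< N (λ j → Σ< (suc n) (λ i → expTerm x j * (a i * p (i ℕ.+ j))))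
      ≡⟨ Σ<-cong N (λ j _ → sym (*-distribˡ-Σ< (suc n) (expTerm x j) _)) ⟩
    Σ< N (λ j → expTerm x j * Δ n p j)
      ≡⟨ Σ<-cong N (λ j _ → trans (cong (expTerm x j *_) (Δp≡κ j)) (ℚₚ.*-comm (expTerm x j) κ)) ⟩
    Σ< N (λ j → κ * expTerm x j)
      ≡⟨ sym (*-distribˡ-Σ< N κ (expTerm x)) ⟩
    κ * Σ< N (expTerm x)
      ∎
    where
    open ≡-Reasoning
    a : ℕ → ℚ
    a i = fromℕ (n C i) * (- 1ℚ) ^ i

  Σ<-lhsTerm : ∀ N → Σ< (N ℕ.+ n) (lhsTerm n) ≡ κ * Σ< N (expTerm x) + tail₁ N
  Σ<-lhsTerm N = begin
    Σ< (N ℕ.+ n) (lhsTerm n)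
      ≡⟨ Σ<-cong (N ℕ.+ n) (λ m _ → trans (lhsTerm≡expTerm*p² m) (expand m)) ⟩
    Σ< (N ℕ.+ n) (λ m → Σ< (suc n) (λ i → coeff i * term i m)) ≡⟨ Σ<-comm (N ℕ.+ n) (suc n) _ ⟩
    Σ< (suc n) (λ i → Σ< (N ℕ.+ n) (λ m → coeff i * term i m))
      ≡⟨ Σ<-cong (suc n) (λ i _ → sym (*-distribˡ-Σ< (N ℕ.+ n) (coeff i) (term i))) ⟩
    Σ< (suc n) (λ i → coeff i * Σ< (N ℕ.+ n) (term i))
      ≡⟨ Σ<-cong (suc n) (λ i i<1+n → split i (ℕₚ.m<1+n⇒m≤n i<1+n)) ⟩
    Σ< (suc n) (λ i → fromℕ (n C i) * (- 1ℚ) ^ i * Q i + coeff i * R i) ≡⟨ Σ<-distrib-+ (suc n) _ _ ⟩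
    Σ< (suc n) (λ i → fromℕ (n C i) * (- 1ℚ) ^ i * Q i) + tail₁ N      ≡⟨ cong (_+ tail₁ N) (Σ<-alternating N) ⟩
    κ * Σ< N (expTerm x) + tail₁ N                            ∎
    where
    open ≡-Reasoning
    Q R : ℕ → ℚ
    Q i = Σ< N (λ j → expTerm x j * p (i ℕ.+ j))
    R i = Σ< (n ∸ i) (λ t → term i (i ℕ.+ N ℕ.+ t))
    expand : ∀ m → expTerm x m * (p m * p m) ≡ Σ< (suc n) (λ i → coeff i * term i m)
    expand m = begin
      expTerm x m * (p m * p m)                                          ≡⟨ sym (ℚₚ.*-assoc (expTerm x m) (p m) (p m)) ⟩
      expTerm x m * p m * p m
        ≡⟨ *-distribˡ-Σ< (suc n) (expTerm x m * p m) _ ⟩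
      Σ< (suc n) (λ i → expTerm x m * p m * (coeff i * fromℕ (m C i)))
        ≡⟨ Σ<-cong (suc n) (λ i _ → solve 4 (λ e q c b → e :* q :* (c :* b) := c :* (e :* b :* q))
             refl (expTerm x m) (p m) (coeff i) (fromℕ (m C i))) ⟩
      Σ< (suc n) (λ i → coeff i * term i m)                              ∎
    split : ∀ i → i ≤ n → coeff i * Σ< (N ℕ.+ n) (term i) ≡ fromℕ (n C i) * (- 1ℚ) ^ i * Q i + coeff i * R i
    split i i≤n = begin
      coeff i * Σ< (N ℕ.+ n) (term i)               ≡⟨ cong (coeff i *_) (Σ<-term N i i≤n) ⟩
      coeff i * (expTerm x i * Q i + R i)
        ≡⟨ solve 4 (λ c e q r → c :* (e :* q :+ r) := c :* e :* q :+ c :* r) refl (coeff i) (expTerm x i) (Q i) (R i) ⟩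
      coeff i * expTerm x i * Q i + coeff i * R i   ≡⟨ cong (λ y → y * Q i + coeff i * R i) (coeff*expTerm i i≤n) ⟩
      fromℕ (n C i) * (- 1ℚ) ^ i * Q i + coeff i * R i ∎

  B : ℚ
  B = Σ< (suc n) (λ i → ∣ coeff i ∣)

  0≤B : 0ℚ ℚ.≤ B
  0≤B = subst (ℚ._≤ B) (Σ<-zero (suc n) (λ _ _ → refl)) (Σ<-mono-≤ (suc n) (λ i _ → ℚₚ.0≤∣p∣ (coeff i)))

  0≤κ : 0ℚ ℚ.≤ κ
  0≤κ = nonNeg*nonNeg⇒nonNeg (0≤fromℕ (n !)) (0≤1/ℕ (n ℕ.^ n))

  ∣fromℕ∣ : ∀ a → ∣ fromℕ a ∣ ≡ fromℕ a
  ∣fromℕ∣ a = ℚₚ.0≤p⇒∣p∣≡p (0≤fromℕ a)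

  ∣p∣≤ : ∀ m → ∣ p m ∣ ℚ.≤ B * fromℕ (2 ℕ.^ m)
  ∣p∣≤ m = ∣Σ<*∣≤ (suc n) coeff (λ i → fromℕ (m C i)) (fromℕ (2 ℕ.^ m))
    (λ i _ → ℚₚ.≤-trans (ℚₚ.≤-reflexive (∣fromℕ∣ (m C i))) (fromℕ-mono-≤ (nCk≤2^n m i)))

  K : ℕ
  K = 2 ℕ.* (4 ℕ.* n)

  u : ℕ → ℚ
  u = expTerm (fromℕ (4 ℕ.* n))

  u-decays : Decays K u
  u-decays = expTerm-decays (4 ℕ.* n)

  0≤expTerm : ∀ m → 0ℚ ℚ.≤ expTerm x m
  0≤expTerm = Decays.nonNeg (expTerm-decays n)

  u≡2^m*2^m*expTerm : ∀ m → u m ≡ fromℕ (2 ℕ.^ m) * fromℕ (2 ℕ.^ m) * expTerm x m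
  u≡2^m*2^m*expTerm m = begin
    fromℕ (4 ℕ.* n) ^ m * expCoeff m               ≡⟨ cong (λ y → y ^ m * expCoeff m) (fromℕ-homo-* 4 n) ⟩
    (fromℕ 2 * fromℕ 2 * x) ^ m * expCoeff m       ≡⟨ cong (_* expCoeff m) (^-distrib-* (fromℕ 2 * fromℕ 2) x m) ⟩
    (fromℕ 2 * fromℕ 2) ^ m * x ^ m * expCoeff m
      ≡⟨ cong (λ y → y * x ^ m * expCoeff m) (^-distrib-* (fromℕ 2) (fromℕ 2) m) ⟩
    fromℕ 2 ^ m * fromℕ 2 ^ m * x ^ m * expCoeff m ≡⟨ cong (λ y → y * y * x ^ m * expCoeff m) (sym (fromℕ-homo-^ 2 m)) ⟩
    T * T * x ^ m * expCoeff m                     ≡⟨ ℚₚ.*-assoc (T * T) (x ^ m) (expCoeff m) ⟩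
    T * T * expTerm x m                            ∎
    where
    open ≡-Reasoning
    T : ℚ
    T = fromℕ (2 ℕ.^ m)

  expTerm≤u : ∀ m → expTerm x m ℚ.≤ u m
  expTerm≤u m = begin
    expTerm x m             ≡⟨ sym (ℚₚ.*-identityˡ (expTerm x m)) ⟩
    1ℚ * expTerm x m        ≤⟨ *-monoʳ-≤-nonNeg (0≤expTerm m) 1≤T*T ⟩
    T * T * expTerm x m     ≡⟨ sym (u≡2^m*2^m*expTerm m) ⟩
    u m                     ∎
    where
    open ℚₚ.≤-Reasoning
    T : ℚ
    T = fromℕ (2 ℕ.^ m)
    1≤T*T : 1ℚ ℚ.≤ T * T
    1≤T*T = ℚₚ.≤-trans (fromℕ-mono-≤ {1} (ℕₚ.*-mono-≤ (ℕₚ.m^n>0 2 m) (ℕₚ.m^n>0 2 m)))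
                       (ℚₚ.≤-reflexive (fromℕ-homo-* (2 ℕ.^ m) (2 ℕ.^ m)))

  ∣term∣≤ : ∀ i m → ∣ term i m ∣ ℚ.≤ B * u m
  ∣term∣≤ i m = begin
    ∣ expTerm x m * fromℕ (m C i) * p m ∣      ≡⟨ ℚₚ.∣p*q∣≡∣p∣*∣q∣ (expTerm x m * fromℕ (m C i)) (p m) ⟩
    ∣ expTerm x m * fromℕ (m C i) ∣ * ∣ p m ∣  ≡⟨ cong (_* ∣ p m ∣) (ℚₚ.0≤p⇒∣p∣≡p 0≤e*C) ⟩
    expTerm x m * fromℕ (m C i) * ∣ p m ∣      ≤⟨ *-mono-≤-nonNeg 0≤e*C (ℚₚ.0≤∣p∣ (p m))
                                                    (*-monoˡ-≤-nonNeg (0≤expTerm m) (fromℕ-mono-≤ (nCk≤2^n m i))) (∣p∣≤ m) ⟩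
    expTerm x m * T * (B * T)
      ≡⟨ solve 3 (λ e t b → e :* t :* (b :* t) := b :* (t :* t :* e)) refl (expTerm x m) T B ⟩
    B * (T * T * expTerm x m)                  ≡⟨ cong (B *_) (sym (u≡2^m*2^m*expTerm m)) ⟩
    B * u m                                    ∎
    where
    open ℚₚ.≤-Reasoning
    T : ℚ
    T = fromℕ (2 ℕ.^ m)
    0≤e*C : 0ℚ ℚ.≤ expTerm x m * fromℕ (m C i)
    0≤e*C = nonNeg*nonNeg⇒nonNeg (0≤expTerm m) (0≤fromℕ (m C i))

  ∣tail₁∣≤ : ∀ N → K ≤ N → ∣ tail₁ N ∣ ℚ.≤ B * (fromℕ n * (B * u N))
  ∣tail₁∣≤ N K≤N = ∣Σ<*∣≤ (suc n) coeff _ (fromℕ n * (B * u N)) inner-bound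
    where
    0≤B*uN : 0ℚ ℚ.≤ B * u N
    0≤B*uN = nonNeg*nonNeg⇒nonNeg 0≤B (Decays.nonNeg u-decays N)
    inner-bound : ∀ i → i ℕ.< suc n → ∣ Σ< (n ∸ i) (λ t → term i (i ℕ.+ N ℕ.+ t)) ∣ ℚ.≤ fromℕ n * (B * u N)
    inner-bound i _ = ℚₚ.≤-trans
      (∣Σ<∣≤N* (n ∸ i) _ (B * u N) (λ t _ → ℚₚ.≤-trans (∣term∣≤ i (i ℕ.+ N ℕ.+ t))
        (*-monoˡ-≤-nonNeg 0≤B (antitone u-decays K≤N (ℕₚ.≤-trans (ℕₚ.m≤n+m N i) (ℕₚ.m≤m+n (i ℕ.+ N) t))))))
      (*-monoʳ-≤-nonNeg 0≤B*uN (fromℕ-mono-≤ (ℕₚ.m∸n≤m n i)))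

  ∣tail₂∣≤ : ∀ N → K ≤ N → ∣ tail₂ N ∣ ℚ.≤ fromℕ n * (κ * u N)
  ∣tail₂∣≤ N K≤N = ∣Σ<∣≤N* n _ (κ * u N) (λ t _ → ℚₚ.≤-trans
    (ℚₚ.≤-reflexive (ℚₚ.0≤p⇒∣p∣≡p (nonNeg*nonNeg⇒nonNeg 0≤κ (0≤expTerm (N ℕ.+ t)))))
    (*-monoˡ-≤-nonNeg 0≤κ (ℚₚ.≤-trans (expTerm≤u (N ℕ.+ t)) (antitone u-decays K≤N (ℕₚ.m≤m+n N t)))))

  C : ℚ
  C = fromℕ n * (B * B + κ)

  0≤C : 0ℚ ℚ.≤ C
  0≤C = nonNeg*nonNeg⇒nonNeg (0≤fromℕ n) (ℚₚ.≤-trans (ℚₚ.≤-reflexive (sym (ℚₚ.+-identityˡ 0ℚ)))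
                                          (ℚₚ.+-mono-≤ (nonNeg*nonNeg⇒nonNeg 0≤B 0≤B) 0≤κ))

  ∣Σ<lhsTerm-Σ<rhsTerm∣≤ : ∀ N → K ≤ N → ∣ Σ< (N ℕ.+ n) (lhsTerm n) - Σ< (N ℕ.+ n) (rhsTerm n) ∣ ℚ.≤ C * u N
  ∣Σ<lhsTerm-Σ<rhsTerm∣≤ N K≤N = begin
    ∣ Σ< (N ℕ.+ n) (lhsTerm n) - Σ< (N ℕ.+ n) (rhsTerm n) ∣  ≡⟨ cong ∣_∣ (cong₂ _-_ (Σ<-lhsTerm N) (Σ<-rhsTerm N)) ⟩
    ∣ (main + tail₁ N) - (main + tail₂ N) ∣
      ≡⟨ cong ∣_∣ (solve 3 (λ a s t → (a :+ s) :- (a :+ t) := s :- t) refl main (tail₁ N) (tail₂ N)) ⟩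
    ∣ tail₁ N - tail₂ N ∣                                    ≤⟨ ℚₚ.∣p-q∣≤∣p∣+∣q∣ (tail₁ N) (tail₂ N) ⟩
    ∣ tail₁ N ∣ + ∣ tail₂ N ∣                                ≤⟨ ℚₚ.+-mono-≤ (∣tail₁∣≤ N K≤N) (∣tail₂∣≤ N K≤N) ⟩
    B * (fromℕ n * (B * u N)) + fromℕ n * (κ * u N)
      ≡⟨ solve 4 (λ b m w k → b :* (m :* (b :* w)) :+ m :* (k :* w) := m :* (b :* b :+ k) :* w) refl B (fromℕ n) (u N) κ ⟩
    C * u N                                                  ∎
    where
    open ℚₚ.≤-Reasoning
    main : ℚ
    main = κ * Σ< N (expTerm x)

lemma8 : (n : ℕ) → .{{_ : NonZero n}} → (ε : ℚ) → 0ℚ < ε →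
    ∃ λ N → (M : ℕ) → N ≤ M →
      ∣ Σ< M (lhsTerm n) - Σ< M (rhsTerm n) ∣ < ε
lemma8 n ε 0<ε = N₀ ℕ.+ K ℕ.+ n , close
  where
  open Series n
  open Decay using (eventually-<; *-decays)
  small : ∃ λ N₀ → ∀ N → N₀ ≤ N → C * u N < ε
  small = eventually-< (*-decays 0≤C u-decays) ε 0<ε
  N₀ : ℕ
  N₀ = proj₁ small
  close : ∀ M → N₀ ℕ.+ K ℕ.+ n ≤ M → ∣ Σ< M (lhsTerm n) - Σ< M (rhsTerm n) ∣ < ε
  close M N₀+K+n≤M = begin-strict
    ∣ Σ< M (lhsTerm n) - Σ< M (rhsTerm n) ∣
      ≡⟨ cong (λ M → ∣ Σ< M (lhsTerm n) - Σ< M (rhsTerm n) ∣) (sym M∸n+n≡M) ⟩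
    ∣ Σ< (N ℕ.+ n) (lhsTerm n) - Σ< (N ℕ.+ n) (rhsTerm n) ∣  ≤⟨ ∣Σ<lhsTerm-Σ<rhsTerm∣≤ N (ℕₚ.m+n≤o⇒n≤o N₀ N₀+K≤N) ⟩
    C * u N                                                  <⟨ proj₂ small N (ℕₚ.m+n≤o⇒m≤o N₀ N₀+K≤N) ⟩
    ε                                                        ∎
    where
    open ℚₚ.≤-Reasoning
    N : ℕ
    N = M ∸ n
    N₀+K≤N : N₀ ℕ.+ K ≤ N
    N₀+K≤N = ℕₚ.m+n≤o⇒m≤o∸n (N₀ ℕ.+ K) N₀+K+n≤M
    M∸n+n≡M : N ℕ.+ n ≡ M
    M∸n+n≡M = ℕₚ.m∸n+n≡m (ℕₚ.m+n≤o⇒n≤o (N₀ ℕ.+ K) N₀+K+n≤M)
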